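{- There is a polynomial function $P$ such that for every positive integer $n$, the set $Q_n$ has a PCR/$\mathbb{Q}$ refutation of degree at most $2$ and of monomial-size at most $P(n)$.
   Context: For a positive integer $n$, consider Boolean variables $x_{ij}$ with twin variables $\bar{x}_{ij}$ for $i\in[n]$, $j\in[2n]$. Let $\mathrm{ks}_i=\sum_{j\in[2n]}x_{ij}-n$. The set $Q_n$ consists of the equality constraints: $\mathrm{ks}_1=1/2$; $\mathrm{ks}_i^2=\mathrm{ks}_{i+1}$ for each $i\in[n-1]$; and $\mathrm{ks}_n^2=0$ (each constraint $p=q$ is viewed as the polynomial $p-q$). The logical axioms are $x_{ij}^2-x_{ij}$ and $x_{ij}+\bar{x}_{ij}-1$. A PCR/$\mathbb{Q}$ proof of $p=0$ from a set $Q$ of polynomials is a sequence $p_1,\ldots,p_\ell=p$ of rational polynomials where each $p_i$ is in $Q$, is a logical axiom, equals $xp_j$ for some $j<i$ and variable $x$, or equals $ap_j+bp_k$ for some $j,k<i$ and $a,b\in\mathbb{Q}$. A refutation is a proof of $1=0$. Its degree is the maximum degree of the $p_i$; its monomial-size is the total number of monomials, counted with multiplicity, in all the $p_i$. -}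

module Defs where

open import Data.Nat as ℕ using (ℕ; zero; suc; _≤_; _⊔_)
import Data.Nat.Properties as ℕP
open import Data.Integer using (+_)
open import Data.Rational as ℚ using (ℚ; 0ℚ; 1ℚ; ½)
import Data.Rational.Properties as ℚP
open import Data.Fin using (Fin; inject₁; fromℕ) renaming (zero to fzero; suc to fsuc)
open import Data.Bool using (Bool; true; false)
open import Data.Product using (_×_; _,_; proj₁; proj₂; Σ; ∃; ∃-syntax)
import Data.Product.Properties as ×P
open import Data.Sum using (_⊎_)
open import Data.List as L using (List; []; _∷_; length; filter; deduplicate; lookup; take; foldr)
open import Data.List.Membership.Propositional using (_∈_)
open import Data.Vec as V using (Vec; replicate; updateAt; zipWith)
import Data.Vec.Properties as VP
open import Relation.Binary.PropositionalEquality using (_≡_)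
open import Relation.Nullary using (¬_; yes; no)
open import Relation.Nullary.Decidable using (¬?)
open import Relation.Binary.Definitions using (DecidableEquality)

-- Variables of the formula Q_n: x_{ij} (flag false) and its twin
-- x̄_{ij} (flag true), for i ∈ [n] (Fin n), j ∈ [2n] (Fin (n + n)).

Var : ℕ → Set
Var n = Fin n × Fin (n ℕ.+ n) × Bool

-- A monomial: for each i, j the pair (exponent of x_ij , exponent of x̄_ij).
Mon : ℕ → Set
Mon n = Vec (Vec (ℕ × ℕ) (n ℕ.+ n)) n

_≟M_ : ∀ {n} → DecidableEquality (Mon n)
_≟M_ = VP.≡-dec (VP.≡-dec (×P.≡-dec ℕP._≟_ ℕP._≟_))

mon1 : ∀ {n} → Mon n
mon1 = replicate _ (replicate _ (0 , 0))

bump : Bool → ℕ × ℕ → ℕ × ℕ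
bump false (a , b) = (suc a , b)
bump true  (a , b) = (a , suc b)

mulVarM : ∀ {n} → Var n → Mon n → Mon n
mulVarM (i , j , t) m = updateAt m i (λ row → updateAt row j (bump t))

mulM : ∀ {n} → Mon n → Mon n → Mon n
mulM = zipWith (zipWith (λ p q → (proj₁ p ℕ.+ proj₁ q , proj₂ p ℕ.+ proj₂ q)))

degM : ∀ {n} → Mon n → ℕ
degM m = V.sum (V.map (λ row → V.sum (V.map (λ p → proj₁ p ℕ.+ proj₂ p) row)) m)

-- Rational polynomials in these variables, given as formal sums of terms.
-- Two formal sums denote the same polynomial iff all coefficients agree.

Poly : ℕ → Set
Poly n = List (ℚ × Mon n)

coeff : ∀ {n} → Poly n → Mon n → ℚ
coeff [] m = 0ℚ
coeff ((c , m′) ∷ p) m with m′ ≟M m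
... | yes _ = c ℚ.+ coeff p m
... | no  _ = coeff p m

_≈_ : ∀ {n} → Poly n → Poly n → Set
p ≈ q = ∀ m → coeff p m ≡ coeff q m

support : ∀ {n} → Poly n → List (Mon n)
support p = filter (λ m → ¬? (coeff p m ℚP.≟ 0ℚ)) (deduplicate _≟M_ (L.map proj₂ p))

nMon : ∀ {n} → Poly n → ℕ
nMon p = length (support p)

-- degree of p (the zero polynomial gets degree 0)
deg : ∀ {n} → Poly n → ℕ
deg p = foldr (λ m d → degM m ⊔ d) 0 (support p)

const : ∀ {n} → ℚ → Poly n
const c = (c , mon1) ∷ []

var : ∀ {n} → Var n → Poly n
var v = (1ℚ , mulVarM v mon1) ∷ []

scale : ∀ {n} → ℚ → Poly n → Poly n
scale a = L.map (λ t → (a ℚ.* proj₁ t , proj₂ t))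

_⊕_ : ∀ {n} → Poly n → Poly n → Poly n
p ⊕ q = p L.++ q

_⊖_ : ∀ {n} → Poly n → Poly n → Poly n
p ⊖ q = p ⊕ scale (ℚ.- 1ℚ) q

_⊗_ : ∀ {n} → Poly n → Poly n → Poly n
p ⊗ q = L.concatMap (λ s → L.map (λ t → (proj₁ s ℚ.* proj₁ t , mulM (proj₂ s) (proj₂ t))) q) p

mulVar : ∀ {n} → Var n → Poly n → Poly n
mulVar v = L.map (λ t → (proj₁ t , mulVarM v (proj₂ t)))

fromℕℚ : ℕ → ℚ
fromℕℚ k = + k ℚ./ 1

ks : ∀ {n} → Fin n → Poly n
ks {n} i = L.foldr (λ j acc → var (i , j , false) ⊕ acc) [] (L.allFin (n ℕ.+ n))
           ⊖ const (fromℕℚ n)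

-- Q_n (for n = 0 it is empty; the theorem only concerns n ≥ 1)
Q : (n : ℕ) → List (Poly n)
Q zero = []
Q (suc m) =
  (ks fzero ⊖ const ½)
  ∷ (L.map (λ i → (ks (inject₁ i) ⊗ ks (inject₁ i)) ⊖ ks (fsuc i)) (L.allFin m)
     L.++ ((ks (fromℕ m) ⊗ ks (fromℕ m)) ∷ []))

LogicalAxiom : ∀ {n} → Poly n → Set
LogicalAxiom {n} p = Σ (Fin n) λ i → Σ (Fin (n ℕ.+ n)) λ j →
    (p ≈ ((var (i , j , false) ⊗ var (i , j , false)) ⊖ var (i , j , false)))
  ⊎ (p ≈ ((var (i , j , false) ⊕ var (i , j , true)) ⊖ const 1ℚ))

Step : ∀ {n} → List (Poly n) → List (Poly n) → Poly n → Set
Step {n} A prev p =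
    (Σ (Poly n) λ q → q ∈ A × p ≈ q)
  ⊎ LogicalAxiom p
  ⊎ (Σ (Fin (length prev)) λ k → Σ (Var n) λ x → p ≈ mulVar x (lookup prev k))
  ⊎ (Σ (Fin (length prev)) λ j → Σ (Fin (length prev)) λ k → Σ ℚ λ a → Σ ℚ λ b →
       p ≈ (scale a (lookup prev j) ⊕ scale b (lookup prev k)))

IsDerivation : ∀ {n} → List (Poly n) → List (Poly n) → Set
IsDerivation A ps = ∀ (i : Fin (length ps)) → Step A (take (Data.Fin.toℕ i) ps) (lookup ps i)

IsRefutation : ∀ {n} → List (Poly n) → List (Poly n) → Set
IsRefutation A ps = IsDerivation A ps × Σ (Poly _) λ p → Σ (List (Poly _)) λ qs →
  ps ≡ qs L.++ (p ∷ []) × p ≈ const 1ℚ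

degree : ∀ {n} → List (Poly n) → ℕ
degree ps = foldr (λ p d → deg p ⊔ d) 0 ps

monomialSize : ∀ {n} → List (Poly n) → ℕ
monomialSize ps = foldr (λ p s → nMon p ℕ.+ s) 0 ps

-- polynomial functions ℕ → ℕ, given by coefficient lists c₀, c₁, …
evalP : List ℕ → ℕ → ℕ
evalP [] x = 0
evalP (c ∷ cs) x = c ℕ.+ x ℕ.* evalP cs x

-- Write E_a(c) for the line ks_a − c (eqn a c).  From E_a(c) one derives ks_a² − c² in degree 2 with
-- O(n) lines: start from (c − n)·E_a(c) and add x_{aj}·E_a(c) for every j ∈ [2n]; since
-- ks_a = Σ_j x_{aj} − n, the sum is (ks_a + c)·E_a(c).  Subtracting the axiom ks_a² − ks_{a+1}
-- gives E_{a+1}(c²).  Starting from the axiom E_1(½) this yields E_n(c) with c = ½^(2^(n−1)) ≠ 0,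
-- and then c⁻²·(ks_n² − (ks_n² − c²)) = 1.  All n blocks have O(n) lines of O(n²) terms each,
-- so the refutation has monomial-size O(n⁴).  Identities between polynomials are checked one
-- monomial at a time, where coeff is linear.
module Submission where

open import Defs
open import Data.Nat using (ℕ; _≤_)
open import Data.List using (List)
open import Data.Product using (Σ; _×_)

open import Data.Nat as ℕ using (zero; suc; _⊔_; z≤n; s≤s)
import Data.Nat.Properties as ℕP
import Data.Nat.Solver as ℕSolver
open import Data.Rational as ℚ using (ℚ; 0ℚ; 1ℚ; ½)
import Data.Rational.Properties as ℚP
open import Data.Rational.Solver using (module +-*-Solver)
open import Data.Fin using (Fin; toℕ; inject₁; fromℕ) renaming (zero to fzero; suc to fsuc)
import Data.Fin.Properties as FinP
open import Data.Fin.Induction using (<-weakInduction)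
open import Data.Bool using (false; true)
open import Data.Product using (_,_; proj₁; proj₂)
open import Data.Sum using (inj₁; inj₂)
open import Data.List as L using ([]; _∷_; _++_; _∷ʳ_; length; foldl; take; lookup)
import Data.List.Properties as LP
open import Data.List.Relation.Unary.All as All using (All; []; _∷_)
import Data.List.Relation.Unary.All.Properties as AllP
open import Data.List.Relation.Unary.Any using (here; there; index)
open import Data.List.Relation.Unary.Any.Properties using (lookup-index)
open import Data.List.Membership.Propositional using (_∈_)
open import Data.List.Membership.Propositional.Properties
  using (∈-++⁺ˡ; ∈-++⁺ʳ; ∈-map⁺; ∈-map⁻; ∈-allFin; ∈-filter⁻; ∈-deduplicate⁻)
open import Data.Vec as V using (Vec; replicate; updateAt; zipWith)
open import Relation.Binary.PropositionalEquality
open import Function using (id; _∘′_; _$_)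
open import Relation.Nullary using (yes; no; ¬?)

zipWith-replicateˡ : ∀ {A : Set} {k} (f : A → A → A) {e : A} → (∀ x → f e x ≡ x) →
                     (xs : Vec A k) → zipWith f (replicate k e) xs ≡ xs
zipWith-replicateˡ f e-identity V.[]       = refl
zipWith-replicateˡ f e-identity (x V.∷ xs) = cong₂ V._∷_ (e-identity x) (zipWith-replicateˡ f e-identity xs)

zipWith-updateAtˡ : ∀ {A : Set} {k} (f : A → A → A) {g h : A → A} → (∀ x y → f (g x) y ≡ h (f x y)) →
                    (xs ys : Vec A k) (i : Fin k) →
                    zipWith f (updateAt xs i g) ys ≡ updateAt (zipWith f xs ys) i h
zipWith-updateAtˡ f commute (x V.∷ xs) (y V.∷ ys) fzero    = cong (V._∷ _) (commute x y)
zipWith-updateAtˡ f commute (x V.∷ xs) (y V.∷ ys) (fsuc i) =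
  cong (_ V.∷_) (zipWith-updateAtˡ f commute xs ys i)

sum-map-replicate : ∀ {A : Set} (f : A → ℕ) {x : A} → f x ≡ 0 →
                    ∀ k → V.sum (V.map f (replicate k x)) ≡ 0
sum-map-replicate f fx≡0 zero    = refl
sum-map-replicate f fx≡0 (suc k) = cong₂ ℕ._+_ fx≡0 (sum-map-replicate f fx≡0 k)

sum-map-updateAt : ∀ {A : Set} {k} (f : A → ℕ) {g : A → A} → (∀ x → f (g x) ≡ suc (f x)) →
                   (xs : Vec A k) (i : Fin k) → V.sum (V.map f (updateAt xs i g)) ≡ suc (V.sum (V.map f xs))
sum-map-updateAt f increments (x V.∷ xs) fzero    = cong (ℕ._+ V.sum (V.map f xs)) (increments x)
sum-map-updateAt f increments (x V.∷ xs) (fsuc i) =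
  trans (cong (f x ℕ.+_) (sum-map-updateAt f increments xs i)) (ℕP.+-suc (f x) _)

*-square-inverse : ∀ {c d : ℚ} → d ℚ.* c ≡ 1ℚ → (d ℚ.* d) ℚ.* (c ℚ.* c) ≡ 1ℚ
*-square-inverse {c} {d} dc≡1 = begin
  (d ℚ.* d) ℚ.* (c ℚ.* c)  ≡⟨ solve 2 (λ c d → (d :* d) :* (c :* c) := (d :* c) :* (d :* c)) refl c d ⟩
  (d ℚ.* c) ℚ.* (d ℚ.* c)  ≡⟨ cong₂ ℚ._*_ dc≡1 dc≡1 ⟩
  1ℚ                       ∎
  where
  open ≡-Reasoning
  open +-*-Solver using (solve; _:*_; _:=_)

module _ {n : ℕ} where

  addExponents : ℕ × ℕ → ℕ × ℕ → ℕ × ℕ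
  addExponents p q = (proj₁ p ℕ.+ proj₁ q , proj₂ p ℕ.+ proj₂ q)

  mulM-identityˡ : (m : Mon n) → mulM mon1 m ≡ m
  mulM-identityˡ = zipWith-replicateˡ _ (zipWith-replicateˡ addExponents (λ _ → refl))

  mulM-mulVarMˡ : (v : Var n) (a b : Mon n) → mulM (mulVarM v a) b ≡ mulVarM v (mulM a b)
  mulM-mulVarMˡ (i , j , t) a b =
    zipWith-updateAtˡ _ (λ x y → zipWith-updateAtˡ addExponents (bump-addExponents t) x y j) a b i
    where
    bump-addExponents : ∀ t x y → addExponents (bump t x) y ≡ bump t (addExponents x y)
    bump-addExponents false x y = refl
    bump-addExponents true  x y = refl

  degM-mon1 : degM (mon1 {n}) ≡ 0
  degM-mon1 = sum-map-replicate _ (sum-map-replicate _ refl (n ℕ.+ n)) n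

  degM-mulVarM : (v : Var n) (a : Mon n) → degM (mulVarM v a) ≡ suc (degM a)
  degM-mulVarM (i , j , t) a = sum-map-updateAt _ (λ row → sum-map-updateAt _ (bump-degree t) row j) a i
    where
    bump-degree : ∀ t (e : ℕ × ℕ) → proj₁ (bump t e) ℕ.+ proj₂ (bump t e) ≡ suc (proj₁ e ℕ.+ proj₂ e)
    bump-degree false e = refl
    bump-degree true  e = ℕP.+-suc (proj₁ e) (proj₂ e)

  rowSum : Fin n → List (Fin (n ℕ.+ n)) → Poly n
  rowSum i = L.foldr (λ j acc → var (i , j , false) ⊕ acc) []

  mulVar-scale : (v : Var n) (a : ℚ) (p : Poly n) → mulVar v (scale a p) ≡ scale a (mulVar v p)
  mulVar-scale v a []      = refl
  mulVar-scale v a (t ∷ p) = cong (_ ∷_) (mulVar-scale v a p)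

  mulVar-⊖ : (v : Var n) (p q : Poly n) → mulVar v (p ⊖ q) ≡ mulVar v p ⊖ mulVar v q
  mulVar-⊖ v p q =
    trans (LP.map-++ _ p (scale (ℚ.- 1ℚ) q)) (cong (mulVar v p ⊕_) (mulVar-scale v (ℚ.- 1ℚ) q))

  ⊗-distribʳ-⊕ : (p q r : Poly n) → (p ⊕ q) ⊗ r ≡ (p ⊗ r) ⊕ (q ⊗ r)
  ⊗-distribʳ-⊕ p q r = LP.concatMap-++ _ p q

  var-⊗ : (v : Var n) (r : Poly n) → var v ⊗ r ≡ mulVar v r
  var-⊗ v r = trans (LP.++-identityʳ _) (LP.map-cong (λ t → cong₂ _,_ (ℚP.*-identityˡ _)
    (trans (mulM-mulVarMˡ v mon1 _) (cong (mulVarM v) (mulM-identityˡ _)))) r)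

  const-⊗ : (a : ℚ) (r : Poly n) → const a ⊗ r ≡ scale a r
  const-⊗ a r = trans (LP.++-identityʳ _) (LP.map-cong (λ t → cong (_ ,_) (mulM-identityˡ _)) r)

  rowSum-⊗ : ∀ i j l (r : Poly n) → rowSum i (j ∷ l) ⊗ r ≡ mulVar (i , j , false) r ⊕ (rowSum i l ⊗ r)
  rowSum-⊗ i j l r = trans (⊗-distribʳ-⊕ (var (i , j , false)) (rowSum i l) r)
                            (cong (_⊕ (rowSum i l ⊗ r)) (var-⊗ (i , j , false) r))

  ks-⊗ : ∀ i (r : Poly n) → ks i ⊗ r ≡ (rowSum i (L.allFin _) ⊗ r) ⊕ scale (ℚ.- 1ℚ ℚ.* fromℕℚ n) r
  ks-⊗ i r = trans (⊗-distribʳ-⊕ (rowSum i (L.allFin _)) _ r)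
                   (cong ((rowSum i (L.allFin _) ⊗ r) ⊕_) (const-⊗ (ℚ.- 1ℚ ℚ.* fromℕℚ n) r))

  length-⊗ : (p q : Poly n) → length (p ⊗ q) ≡ length p ℕ.* length q
  length-⊗ []      q = refl
  length-⊗ (t ∷ p) q = trans (LP.length-++ (L.map _ q)) (cong₂ ℕ._+_ (LP.length-map _ q) (length-⊗ p q))

  coeff-⊕ : (p q : Poly n) (m : Mon n) → coeff (p ⊕ q) m ≡ coeff p m ℚ.+ coeff q m
  coeff-⊕ []             q m = sym (ℚP.+-identityˡ _)
  coeff-⊕ ((c , m′) ∷ p) q m with m′ ≟M m
  ... | yes _ = trans (cong (c ℚ.+_) (coeff-⊕ p q m)) (sym (ℚP.+-assoc c _ _))
  ... | no  _ = coeff-⊕ p q m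

  coeff-scale : (a : ℚ) (p : Poly n) (m : Mon n) → coeff (scale a p) m ≡ a ℚ.* coeff p m
  coeff-scale a []             m = sym (ℚP.*-zeroʳ a)
  coeff-scale a ((c , m′) ∷ p) m with m′ ≟M m
  ... | yes _ = trans (cong (a ℚ.* c ℚ.+_) (coeff-scale a p m)) (sym (ℚP.*-distribˡ-+ a c _))
  ... | no  _ = coeff-scale a p m

  coeff-⊖ : (p q : Poly n) (m : Mon n) → coeff (p ⊖ q) m ≡ coeff p m ℚ.- coeff q m
  coeff-⊖ p q m = trans (coeff-⊕ p (scale (ℚ.- 1ℚ) q) m) (cong (coeff p m ℚ.+_) (begin
    coeff (scale (ℚ.- 1ℚ) q) m  ≡⟨ coeff-scale (ℚ.- 1ℚ) q m ⟩
    ℚ.- 1ℚ ℚ.* coeff q m        ≡⟨ ℚP.neg-distribˡ-* 1ℚ (coeff q m) ⟨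
    ℚ.- (1ℚ ℚ.* coeff q m)      ≡⟨ cong ℚ.-_ (ℚP.*-identityˡ (coeff q m)) ⟩
    ℚ.- coeff q m               ∎))
    where open ≡-Reasoning

  coeff-singleton : (a : ℚ) (M m : Mon n) → coeff ((a , M) ∷ []) m ≡ a ℚ.* coeff ((1ℚ , M) ∷ []) m
  coeff-singleton a M m with M ≟M m
  ... | yes _ =
    trans (ℚP.+-identityʳ a) (sym (trans (cong (a ℚ.*_) (ℚP.+-identityʳ 1ℚ)) (ℚP.*-identityʳ a)))
  ... | no  _ = sym (ℚP.*-zeroʳ a)

  coeff-linear : (a b : ℚ) (p q : Poly n) (m : Mon n) →
                 coeff (scale a p ⊕ scale b q) m ≡ a ℚ.* coeff p m ℚ.+ b ℚ.* coeff q m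
  coeff-linear a b p q m =
    trans (coeff-⊕ (scale a p) (scale b q) m) (cong₂ ℚ._+_ (coeff-scale a p m) (coeff-scale b q m))

  open +-*-Solver using (solve; _:+_; _:-_; _:*_; :-_; con; _:=_)

  ⊖-const-≈ : ∀ {R K P : Poly n} {s} → R ≈ (K ⊖ const s) →
              (P ⊖ const s) ≈ (scale 1ℚ R ⊕ scale (ℚ.- 1ℚ) (K ⊖ P))
  ⊖-const-≈ {R} {K} {P} {s} R≈K-s m = sym (begin
    coeff (scale 1ℚ R ⊕ scale (ℚ.- 1ℚ) (K ⊖ P)) m
      ≡⟨ coeff-linear 1ℚ (ℚ.- 1ℚ) R (K ⊖ P) m ⟩
    1ℚ ℚ.* coeff R m ℚ.+ ℚ.- 1ℚ ℚ.* coeff (K ⊖ P) m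
      ≡⟨ cong₂ (λ r k → 1ℚ ℚ.* r ℚ.+ ℚ.- 1ℚ ℚ.* k)
           (trans (R≈K-s m) (coeff-⊖ K (const s) m)) (coeff-⊖ K P m) ⟩
    1ℚ ℚ.* (κ ℚ.- σ) ℚ.+ ℚ.- 1ℚ ℚ.* (κ ℚ.- π)
      ≡⟨ solve 3 (λ κ σ π → con 1ℚ :* (κ :- σ) :+ (:- con 1ℚ) :* (κ :- π) := π :- σ) refl κ σ π ⟩
    π ℚ.- σ
      ≡⟨ coeff-⊖ P (const s) m ⟨
    coeff (P ⊖ const s) m ∎)
    where
    open ≡-Reasoning
    κ = coeff K m
    σ = coeff (const s) m
    π = coeff P m

  one-≈ : ∀ {R K : Poly n} {s e} → e ℚ.* s ≡ 1ℚ → R ≈ (K ⊖ const s) →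
          const 1ℚ ≈ (scale (ℚ.- e) R ⊕ scale e K)
  one-≈ {R} {K} {s} {e} es≡1 R≈K-s m = sym (begin
    coeff (scale (ℚ.- e) R ⊕ scale e K) m
      ≡⟨ coeff-linear (ℚ.- e) e R K m ⟩
    ℚ.- e ℚ.* coeff R m ℚ.+ e ℚ.* κ
      ≡⟨ cong (λ r → ℚ.- e ℚ.* r ℚ.+ e ℚ.* κ)
           (trans (R≈K-s m) (trans (coeff-⊖ K (const s) m) (cong (ℚ._-_ κ) (coeff-singleton s mon1 m)))) ⟩
    ℚ.- e ℚ.* (κ ℚ.- s ℚ.* υ) ℚ.+ e ℚ.* κ
      ≡⟨ solve 4 (λ e s κ υ → (:- e) :* (κ :- s :* υ) :+ e :* κ := (e :* s) :* υ) refl e s κ υ ⟩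
    (e ℚ.* s) ℚ.* υ
      ≡⟨ trans (cong (ℚ._* υ) es≡1) (ℚP.*-identityˡ υ) ⟩
    υ ∎)
    where
    open ≡-Reasoning
    κ = coeff K m
    υ = coeff (const 1ℚ) m

  DegreeAtMost : ℕ → Poly n → Set
  DegreeAtMost k = All (λ t → degM (proj₂ t) ≤ k)

  degreeAtMost-weaken : ∀ {k l} {p : Poly n} → k ≤ l → DegreeAtMost k p → DegreeAtMost l p
  degreeAtMost-weaken k≤l = All.map (λ d → ℕP.≤-trans d k≤l)

  degreeAtMost-scale : ∀ {k} a {p : Poly n} → DegreeAtMost k p → DegreeAtMost k (scale a p)
  degreeAtMost-scale a = AllP.map⁺

  degreeAtMost-mulVar : ∀ {k} v {p : Poly n} → DegreeAtMost k p → DegreeAtMost (suc k) (mulVar v p)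
  degreeAtMost-mulVar {k} v =
    AllP.map⁺ ∘′ All.map (λ {t} d → subst (_≤ suc k) (sym (degM-mulVarM v (proj₂ t))) (s≤s d))

  degreeAtMost-const : ∀ {k} a → DegreeAtMost k (const {n} a)
  degreeAtMost-const a = subst (_≤ _) (sym degM-mon1) z≤n ∷ []

  degreeAtMost-rowSum : ∀ i l → DegreeAtMost 1 (rowSum i l)
  degreeAtMost-rowSum i []      = []
  degreeAtMost-rowSum i (j ∷ l) =
    AllP.++⁺ (degreeAtMost-mulVar (i , j , false) (degreeAtMost-const 1ℚ)) (degreeAtMost-rowSum i l)

  degreeAtMost-rowSum-⊗ : ∀ {k} i l {r : Poly n} → DegreeAtMost k r → DegreeAtMost (suc k) (rowSum i l ⊗ r)
  degreeAtMost-rowSum-⊗ i []      d = []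
  degreeAtMost-rowSum-⊗ i (j ∷ l) {r} d = subst (DegreeAtMost _) (sym (rowSum-⊗ i j l r))
    (AllP.++⁺ (degreeAtMost-mulVar (i , j , false) d) (degreeAtMost-rowSum-⊗ i l d))

  degreeAtMost-ks : ∀ i → DegreeAtMost 1 (ks {n} i)
  degreeAtMost-ks i = AllP.++⁺ (degreeAtMost-rowSum i (L.allFin _)) (degreeAtMost-const _)

  degreeAtMost-ks-⊗ : ∀ {k} i {r : Poly n} → DegreeAtMost k r → DegreeAtMost (suc k) (ks i ⊗ r)
  degreeAtMost-ks-⊗ i {r} d = subst (DegreeAtMost _) (sym (ks-⊗ i r))
    (AllP.++⁺ (degreeAtMost-rowSum-⊗ i (L.allFin _) d)
              (degreeAtMost-scale (ℚ.- 1ℚ ℚ.* fromℕℚ n) (degreeAtMost-weaken (ℕP.n≤1+n _) d)))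

  support⊆terms : ∀ {p : Poly n} {m} → m ∈ support p → m ∈ L.map proj₂ p
  support⊆terms {p} m∈ =
    ∈-deduplicate⁻ _≟M_ (L.map proj₂ p) (proj₁ (∈-filter⁻ (λ m → ¬? (coeff p m ℚP.≟ 0ℚ)) m∈))

  nMon≤length : (p : Poly n) → nMon p ≤ length p
  nMon≤length p = begin
    nMon p                            ≤⟨ LP.length-filter (λ m → ¬? (coeff p m ℚP.≟ 0ℚ)) (L.deduplicate _≟M_ terms) ⟩
    length (L.deduplicate _≟M_ terms) ≤⟨ LP.length-deduplicate _≟M_ terms ⟩
    length terms                      ≡⟨ LP.length-map proj₂ p ⟩
    length p                          ∎
    where
    open ℕP.≤-Reasoning
    terms = L.map proj₂ p

foldr-⊔-≤ : ∀ {A : Set} (f : A → ℕ) {k} (xs : List A) → All (λ x → f x ≤ k) xs →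
            L.foldr (λ x d → f x ⊔ d) 0 xs ≤ k
foldr-⊔-≤ f []       []         = z≤n
foldr-⊔-≤ f (x ∷ xs) (fx≤k ∷ b) = ℕP.⊔-lub fx≤k (foldr-⊔-≤ f xs b)

deg≤ : ∀ {n k} (p : Poly n) → DegreeAtMost k p → deg p ≤ k
deg≤ p d = foldr-⊔-≤ degM (support p) (All.tabulate λ m∈ → term-bound (support⊆terms m∈))
  where
  term-bound : ∀ {m} → m ∈ L.map proj₂ p → degM m ≤ _
  term-bound m∈ with ∈-map⁻ proj₂ m∈
  ... | t , t∈p , refl = All.lookup d t∈p

degree≤ : ∀ {n k} (ps : List (Poly n)) → All (λ p → deg p ≤ k) ps → degree ps ≤ k
degree≤ = foldr-⊔-≤ deg

monomialSize≤ : ∀ {n b} (ps : List (Poly n)) → All (λ p → nMon p ≤ b) ps →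
                monomialSize ps ≤ length ps ℕ.* b
monomialSize≤ []       []         = z≤n
monomialSize≤ (p ∷ ps) (p≤b ∷ bs) = ℕP.+-mono-≤ p≤b (monomialSize≤ ps bs)

module Derivations {n : ℕ} (A : List (Poly n)) where

  infixr 5 _∷_

  record Justified (pre : List (Poly n)) (q : Poly n) : Set where
    constructor justified
    field step : Step A pre q

  -- Continuation pre qs: the lines qs can be appended, one at a time, to the lines pre.
  data Continuation (pre : List (Poly n)) : List (Poly n) → Set where
    []  : Continuation pre []
    _∷_ : ∀ {q qs} → Justified pre q → Continuation (pre ++ q ∷ []) qs → Continuation pre (q ∷ qs)

  steps : ∀ {pre qs} → Continuation pre qs →
          (i : Fin (length qs)) → Step A (pre ++ take (toℕ i) qs) (lookup qs i)
  steps {pre} (_∷_ {q} (justified s) c) fzero = subst (λ xs → Step A xs q) (sym (LP.++-identityʳ pre)) s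
  steps {pre} (_∷_ {q} {qs} s c) (fsuc i) =
    subst (λ xs → Step A xs (lookup qs i)) (LP.++-assoc pre (q ∷ []) (take (toℕ i) qs)) (steps c i)

  isDerivation : ∀ {ps} → Continuation [] ps → IsDerivation A ps
  isDerivation = steps

  _++ᶜ_ : ∀ {pre qs rs} → Continuation pre qs → Continuation (pre ++ qs) rs → Continuation pre (qs ++ rs)
  _++ᶜ_ {pre} {rs = rs} [] c′ = subst (λ xs → Continuation xs rs) (LP.++-identityʳ pre) c′
  _++ᶜ_ {pre} {rs = rs} (_∷_ {q} {qs} s c) c′ =
    s ∷ (c ++ᶜ subst (λ xs → Continuation xs rs) (sym (LP.++-assoc pre (q ∷ []) qs)) c′)

  byAxiom : ∀ {pre q} → q ∈ A → Justified pre q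
  byAxiom q∈A = justified $ inj₁ (_ , q∈A , λ _ → refl)

  byMulVar : ∀ {pre q} (x : Var n) → q ∈ pre → Justified pre (mulVar x q)
  byMulVar {pre} {q} x q∈pre = justified $ inj₂ (inj₂ (inj₁ (index q∈pre , x ,
    subst (λ r → mulVar x q ≈ mulVar x r) (lookup-index q∈pre) (λ _ → refl))))

  byLinear : ∀ {pre p q r} (a b : ℚ) → q ∈ pre → r ∈ pre →
             p ≈ (scale a q ⊕ scale b r) → Justified pre p
  byLinear {pre} {p} a b q∈pre r∈pre p≈ = justified $ inj₂ (inj₂ (inj₂ (index q∈pre , index r∈pre , a , b ,
    subst₂ (λ q r → p ≈ (scale a q ⊕ scale b r)) (lookup-index q∈pre) (lookup-index r∈pre) p≈)))

module Refutation (m : ℕ) where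

  n : ℕ
  n = suc m

  open Derivations (Q n)

  N : ℕ
  N = n ℕ.+ n

  cols : List (Fin N)
  cols = L.allFin N

  nℚ : ℚ
  nℚ = fromℕℚ n

  x : Fin n → Fin N → Var n
  x a j = (a , j , false)

  eqn : Fin n → ℚ → Poly n
  eqn a c = ks a ⊖ const c

  -- A linear-combination line has two premises; here the second one is weighted by 0.
  start : Fin n → ℚ → Poly n
  start a c = scale (c ℚ.- nℚ) (eqn a c) ⊕ scale 0ℚ (eqn a c)

  accumulate : Fin n → ℚ → Poly n → Fin N → Poly n
  accumulate a c S j = scale 1ℚ S ⊕ scale 1ℚ (mulVar (x a j) (eqn a c))

  loopLines : Fin n → ℚ → Poly n → List (Fin N) → List (Poly n)
  loopLines a c S []      = []
  loopLines a c S (j ∷ l) = mulVar (x a j) (eqn a c) ∷ accumulate a c S j ∷ loopLines a c (accumulate a c S j) l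

  squareDifference : Fin n → ℚ → Poly n
  squareDifference a c = foldl (accumulate a c) (start a c) cols

  block : Fin n → ℚ → Poly n → Poly n → List (Poly n)
  block a c axiom r = (start a c ∷ loopLines a c (start a c) cols ++ axiom ∷ []) ∷ʳ r

  module _ (a : Fin n) (c : ℚ) where

   open +-*-Solver using (solve; _:+_; _:-_; _:*_; :-_; con; _:=_)
   open ≡-Reasoning

   module _ (mo : Mon n) where

    private
      ⟦_⟧ : Poly n → ℚ
      ⟦ p ⟧ = coeff p mo

      υ : ℚ
      υ = ⟦ const 1ℚ ⟧

    coeff-ks : ⟦ ks a ⟧ ≡ ⟦ rowSum a cols ⟧ ℚ.- nℚ ℚ.* υ
    coeff-ks = trans (coeff-⊖ (rowSum a cols) (const nℚ) mo)
                     (cong (ℚ._-_ ⟦ rowSum a cols ⟧) (coeff-singleton nℚ mon1 mo))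

    coeff-eqn : ⟦ eqn a c ⟧ ≡ (⟦ rowSum a cols ⟧ ℚ.- nℚ ℚ.* υ) ℚ.- c ℚ.* υ
    coeff-eqn = trans (coeff-⊖ (ks a) (const c) mo) (cong₂ ℚ._-_ coeff-ks (coeff-singleton c mon1 mo))

    coeff-ks-⊗-ks : ⟦ ks a ⊗ ks a ⟧ ≡
                    ⟦ rowSum a cols ⊗ ks a ⟧ ℚ.+ (ℚ.- 1ℚ ℚ.* nℚ) ℚ.* (⟦ rowSum a cols ⟧ ℚ.- nℚ ℚ.* υ)
    coeff-ks-⊗-ks = begin
      ⟦ ks a ⊗ ks a ⟧
        ≡⟨ cong ⟦_⟧ (ks-⊗ a (ks a)) ⟩
      ⟦ (rowSum a cols ⊗ ks a) ⊕ scale (ℚ.- 1ℚ ℚ.* nℚ) (ks a) ⟧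
        ≡⟨ coeff-⊕ (rowSum a cols ⊗ ks a) (scale (ℚ.- 1ℚ ℚ.* nℚ) (ks a)) mo ⟩
      ⟦ rowSum a cols ⊗ ks a ⟧ ℚ.+ ⟦ scale (ℚ.- 1ℚ ℚ.* nℚ) (ks a) ⟧
        ≡⟨ cong (ℚ._+_ ⟦ rowSum a cols ⊗ ks a ⟧)
             (trans (coeff-scale (ℚ.- 1ℚ ℚ.* nℚ) (ks a) mo) (cong ((ℚ.- 1ℚ ℚ.* nℚ) ℚ.*_) coeff-ks)) ⟩
      ⟦ rowSum a cols ⊗ ks a ⟧ ℚ.+ (ℚ.- 1ℚ ℚ.* nℚ) ℚ.* (⟦ rowSum a cols ⟧ ℚ.- nℚ ℚ.* υ) ∎

    coeff-mulVar-eqn : ∀ j →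
      ⟦ mulVar (x a j) (eqn a c) ⟧ ≡ ⟦ mulVar (x a j) (ks a) ⟧ ℚ.- c ℚ.* ⟦ var (x a j) ⟧
    coeff-mulVar-eqn j = trans (cong ⟦_⟧ (mulVar-⊖ (x a j) (ks a) (const c)))
      (trans (coeff-⊖ (mulVar (x a j) (ks a)) _ mo)
        (cong (ℚ._-_ ⟦ mulVar (x a j) (ks a) ⟧) (coeff-singleton c (mulVarM (x a j) mon1) mo)))

    coeff-loop : ∀ S l →
      ⟦ foldl (accumulate a c) S l ⟧ ≡ ⟦ S ⟧ ℚ.+ (⟦ rowSum a l ⊗ ks a ⟧ ℚ.- c ℚ.* ⟦ rowSum a l ⟧)
    coeff-loop S []      = solve 2 (λ s c → s := s :+ (con 0ℚ :- c :* con 0ℚ)) refl ⟦ S ⟧ c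
    coeff-loop S (j ∷ l) = begin
      ⟦ foldl (accumulate a c) (accumulate a c S j) l ⟧
        ≡⟨ coeff-loop (accumulate a c S j) l ⟩
      ⟦ accumulate a c S j ⟧ ℚ.+ (ρ ℚ.- c ℚ.* ω)
        ≡⟨ cong (ℚ._+ (ρ ℚ.- c ℚ.* ω)) (trans (coeff-linear 1ℚ 1ℚ S _ mo)
             (cong (λ t → 1ℚ ℚ.* ⟦ S ⟧ ℚ.+ 1ℚ ℚ.* t) (coeff-mulVar-eqn j))) ⟩
      (1ℚ ℚ.* ⟦ S ⟧ ℚ.+ 1ℚ ℚ.* (ψ ℚ.- c ℚ.* ξ)) ℚ.+ (ρ ℚ.- c ℚ.* ω)
        ≡⟨ solve 6 (λ s ψ ξ ρ ω c → (con 1ℚ :* s :+ con 1ℚ :* (ψ :- c :* ξ)) :+ (ρ :- c :* ω)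
                                    := s :+ ((ψ :+ ρ) :- c :* (ξ :+ ω))) refl ⟦ S ⟧ ψ ξ ρ ω c ⟩
      ⟦ S ⟧ ℚ.+ ((ψ ℚ.+ ρ) ℚ.- c ℚ.* (ξ ℚ.+ ω))
        ≡⟨ cong₂ (λ r w → ⟦ S ⟧ ℚ.+ (r ℚ.- c ℚ.* w))
             (sym (trans (cong ⟦_⟧ (rowSum-⊗ a j l (ks a))) (coeff-⊕ (mulVar (x a j) (ks a)) _ mo)))
             (sym (coeff-⊕ (var (x a j)) (rowSum a l) mo)) ⟩
      ⟦ S ⟧ ℚ.+ (⟦ rowSum a (j ∷ l) ⊗ ks a ⟧ ℚ.- c ℚ.* ⟦ rowSum a (j ∷ l) ⟧) ∎
      where
      ψ = ⟦ mulVar (x a j) (ks a) ⟧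
      ξ = ⟦ var (x a j) ⟧
      ρ = ⟦ rowSum a l ⊗ ks a ⟧
      ω = ⟦ rowSum a l ⟧

   square-≈ : squareDifference a c ≈ ((ks a ⊗ ks a) ⊖ const (c ℚ.* c))
   square-≈ mo = begin
     coeff (squareDifference a c) mo
       ≡⟨ coeff-loop mo (start a c) cols ⟩
     coeff (start a c) mo ℚ.+ (ρ ℚ.- c ℚ.* ω)
       ≡⟨ cong (ℚ._+ (ρ ℚ.- c ℚ.* ω)) (trans (coeff-linear (c ℚ.- nℚ) 0ℚ (eqn a c) (eqn a c) mo)
            (cong (λ e → (c ℚ.- nℚ) ℚ.* e ℚ.+ 0ℚ ℚ.* e) (coeff-eqn mo))) ⟩
     ((c ℚ.- nℚ) ℚ.* ((ω ℚ.- nℚ ℚ.* υ) ℚ.- c ℚ.* υ) ℚ.+ 0ℚ ℚ.* ((ω ℚ.- nℚ ℚ.* υ) ℚ.- c ℚ.* υ))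
       ℚ.+ (ρ ℚ.- c ℚ.* ω)
       ≡⟨ solve 5 (λ ρ ω υ n c →
            ((c :- n) :* ((ω :- n :* υ) :- c :* υ) :+ con 0ℚ :* ((ω :- n :* υ) :- c :* υ)) :+ (ρ :- c :* ω)
            := (ρ :+ ((:- con 1ℚ) :* n) :* (ω :- n :* υ)) :- (c :* c) :* υ) refl ρ ω υ nℚ c ⟩
     (ρ ℚ.+ (ℚ.- 1ℚ ℚ.* nℚ) ℚ.* (ω ℚ.- nℚ ℚ.* υ)) ℚ.- (c ℚ.* c) ℚ.* υ
       ≡⟨ cong₂ ℚ._-_ (coeff-ks-⊗-ks mo) (coeff-singleton (c ℚ.* c) mon1 mo) ⟨
     coeff (ks a ⊗ ks a) mo ℚ.- coeff (const (c ℚ.* c)) mo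
       ≡⟨ coeff-⊖ (ks a ⊗ ks a) (const (c ℚ.* c)) mo ⟨
     coeff ((ks a ⊗ ks a) ⊖ const (c ℚ.* c)) mo ∎
     where
     ρ = coeff (rowSum a cols ⊗ ks a) mo
     ω = coeff (rowSum a cols) mo
     υ = coeff (const 1ℚ) mo

  module _ (a : Fin n) (c : ℚ) where

    loop-continuation : ∀ S l {pre} → eqn a c ∈ pre → S ∈ pre → Continuation pre (loopLines a c S l)
    loop-continuation S []      e∈ S∈ = []
    loop-continuation S (j ∷ l) {pre} e∈ S∈ =
      byMulVar (x a j) e∈ ∷
      byLinear 1ℚ 1ℚ (∈-++⁺ˡ S∈) (∈-++⁺ʳ pre (here refl)) (λ _ → refl) ∷
      loop-continuation (accumulate a c S j) l (∈-++⁺ˡ (∈-++⁺ˡ e∈)) (∈-++⁺ʳ (pre ++ _ ∷ []) (here refl))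

    foldl∈loop : ∀ S l → foldl (accumulate a c) S l ∈ S ∷ loopLines a c S l
    foldl∈loop S []      = here refl
    foldl∈loop S (j ∷ l) = there (there (foldl∈loop (accumulate a c S j) l))

    block-continuation : ∀ {pre axiom r} α β → eqn a c ∈ pre → axiom ∈ Q n →
                         r ≈ (scale α (squareDifference a c) ⊕ scale β axiom) →
                         Continuation pre (block a c axiom r)
    block-continuation {pre} {axiom} {r} α β e∈ axiom∈Q r≈ = body ++ᶜ (conclusion ∷ [])
      where
      loop = loopLines a c (start a c) cols
      body : Continuation pre (start a c ∷ loop ++ axiom ∷ [])
      body = byLinear (c ℚ.- nℚ) 0ℚ e∈ e∈ (λ _ → refl) ∷
             (loop-continuation (start a c) cols (∈-++⁺ˡ e∈) (∈-++⁺ʳ pre (here refl)) ++ᶜ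
              (byAxiom axiom∈Q ∷ []))
      conclusion : Justified (pre ++ start a c ∷ loop ++ axiom ∷ []) r
      conclusion = byLinear α β (∈-++⁺ʳ pre (∈-++⁺ˡ (foldl∈loop (start a c) cols)))
                                (∈-++⁺ʳ pre (∈-++⁺ʳ (start a c ∷ loop) (here refl))) r≈

    conclusion∈block : ∀ axiom r pre → r ∈ pre ++ block a c axiom r
    conclusion∈block axiom r pre =
      ∈-++⁺ʳ pre (∈-++⁺ʳ (start a c ∷ loopLines a c (start a c) cols ++ axiom ∷ []) (here refl))

  K : ℕ
  K = suc (suc N)

  B : ℕ
  B = K ℕ.* K

  Small : Poly n → Set
  Small p = length p ≤ B × DegreeAtMost 2 p

  length-cols : length cols ≡ N
  length-cols = LP.length-tabulate {n = N} id

  length-rowSum : ∀ (a : Fin n) l → length (rowSum a l) ≡ length l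
  length-rowSum a []      = refl
  length-rowSum a (j ∷ l) = cong suc (length-rowSum a l)

  length-ks : ∀ (a : Fin n) → length (ks a) ≡ suc N
  length-ks a = trans (LP.length-++ (rowSum a cols) {scale (ℚ.- 1ℚ) (const nℚ)})
    (trans (cong (ℕ._+ 1) (trans (length-rowSum a cols) length-cols)) (ℕP.+-comm N 1))

  length-eqn : ∀ (a : Fin n) c → length (eqn a c) ≡ K
  length-eqn a c = trans (LP.length-++ (ks a)) (trans (cong (ℕ._+ 1) (length-ks a)) (ℕP.+-comm (suc N) 1))

  degreeAtMost-eqn : ∀ (a : Fin n) c → DegreeAtMost 1 (eqn a c)
  degreeAtMost-eqn a c = AllP.++⁺ (degreeAtMost-ks a) (degreeAtMost-const _)

  small-eqn : ∀ (a : Fin n) c → Small (eqn a c)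
  small-eqn a c = ℕP.≤-trans (ℕP.≤-reflexive (length-eqn a c)) (ℕP.m≤m*n K K) ,
                  degreeAtMost-weaken (s≤s z≤n) (degreeAtMost-eqn a c)

  B-split : B ≡ (suc N ℕ.* suc N ℕ.+ suc N) ℕ.+ K
  B-split = solve 1 (λ N → (con 2 :+ N) :* (con 2 :+ N)
                         := ((con 1 :+ N) :* (con 1 :+ N) :+ (con 1 :+ N)) :+ (con 2 :+ N)) refl N
    where open ℕSolver.+-*-Solver

  length-square : ∀ (a : Fin n) → length (ks a ⊗ ks a) ≡ suc N ℕ.* suc N
  length-square a = trans (length-⊗ (ks a) (ks a)) (cong₂ ℕ._*_ (length-ks a) (length-ks a))

  small-square : ∀ (a : Fin n) → Small (ks a ⊗ ks a)
  small-square a = ℕP.≤-trans (ℕP.≤-reflexive (length-square a))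
                     (subst (suc N ℕ.* suc N ≤_) (sym B-split)
                       (ℕP.≤-trans (ℕP.m≤m+n _ (suc N)) (ℕP.m≤m+n _ K))) ,
                   degreeAtMost-ks-⊗ a (degreeAtMost-ks a)

  small-squareAxiom : ∀ (a b : Fin n) → Small ((ks a ⊗ ks a) ⊖ ks b)
  small-squareAxiom a b =
    ℕP.≤-trans (ℕP.≤-reflexive (trans (LP.length-++ (ks a ⊗ ks a))
                 (cong₂ ℕ._+_ (length-square a) (trans (LP.length-map _ (ks b)) (length-ks b)))))
               (subst (suc N ℕ.* suc N ℕ.+ suc N ≤_) (sym B-split) (ℕP.m≤m+n _ K)) ,
    AllP.++⁺ (proj₂ (small-square a))
             (degreeAtMost-scale _ (degreeAtMost-weaken (s≤s z≤n) (degreeAtMost-ks b)))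

  blockLength : ℕ
  blockLength = suc (suc (suc (N ℕ.+ N)))

  module _ (a : Fin n) (c : ℚ) where

    length-mulVar-eqn : ∀ j → length (mulVar (x a j) (eqn a c)) ≡ K
    length-mulVar-eqn j = trans (LP.length-map _ (eqn a c)) (length-eqn a c)

    degreeAtMost-mulVar-eqn : ∀ j → DegreeAtMost 2 (mulVar (x a j) (eqn a c))
    degreeAtMost-mulVar-eqn j = degreeAtMost-mulVar (x a j) (degreeAtMost-eqn a c)

    -- length S + length l · K is the length of the last partial sum of the loop.
    small-loop : ∀ S l → length S ℕ.+ length l ℕ.* K ≤ B → DegreeAtMost 2 S →
                 All Small (loopLines a c S l)
    small-loop S []      _     _  = []
    small-loop S (j ∷ l) bound dS =
      (ℕP.≤-trans (ℕP.≤-reflexive (length-mulVar-eqn j)) (ℕP.m≤m*n K K) , degreeAtMost-mulVar-eqn j) ∷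
      (ℕP.≤-trans (ℕP.m≤m+n _ _) bound′ , dS′) ∷
      small-loop S′ l bound′ dS′
      where
      S′ = accumulate a c S j
      bound′ : length S′ ℕ.+ length l ℕ.* K ≤ B
      bound′ = subst (_≤ B) (sym (begin
        length S′ ℕ.+ length l ℕ.* K
          ≡⟨ cong (ℕ._+ length l ℕ.* K) (trans (LP.length-++ (scale 1ℚ S))
               (cong₂ ℕ._+_ (LP.length-map _ S)
                 (trans (LP.length-map _ (mulVar (x a j) (eqn a c))) (length-mulVar-eqn j)))) ⟩
        (length S ℕ.+ K) ℕ.+ length l ℕ.* K
          ≡⟨ ℕP.+-assoc (length S) K _ ⟩
        length S ℕ.+ length (j ∷ l) ℕ.* K ∎)) bound
        where open ≡-Reasoning
      dS′ : DegreeAtMost 2 S′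
      dS′ = AllP.++⁺ (degreeAtMost-scale 1ℚ dS) (degreeAtMost-scale 1ℚ (degreeAtMost-mulVar-eqn j))

    length-start+loop : length (start a c) ℕ.+ length cols ℕ.* K ≡ B
    length-start+loop = begin
      length (start a c) ℕ.+ length cols ℕ.* K
        ≡⟨ cong₂ (λ s l → s ℕ.+ l ℕ.* K) (trans (LP.length-++ (scale (c ℚ.- nℚ) (eqn a c)))
             (cong₂ ℕ._+_ (length-scale-eqn (c ℚ.- nℚ)) (length-scale-eqn 0ℚ)))
             length-cols ⟩
      (K ℕ.+ K) ℕ.+ N ℕ.* K
        ≡⟨ ℕP.+-assoc K K (N ℕ.* K) ⟩
      B ∎
      where
      open ≡-Reasoning
      length-scale-eqn : ∀ α → length (scale α (eqn a c)) ≡ K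
      length-scale-eqn α = trans (LP.length-map _ (eqn a c)) (length-eqn a c)

    degreeAtMost-start : DegreeAtMost 2 (start a c)
    degreeAtMost-start = AllP.++⁺ (degreeAtMost-scale (c ℚ.- nℚ) d) (degreeAtMost-scale 0ℚ d)
      where d = degreeAtMost-weaken (s≤s z≤n) (degreeAtMost-eqn a c)

    small-block : ∀ {axiom r} → Small axiom → Small r → All Small (block a c axiom r)
    small-block small-axiom small-r = AllP.∷ʳ⁺
      ((ℕP.≤-trans (ℕP.m≤m+n _ _) (ℕP.≤-reflexive length-start+loop) , degreeAtMost-start) ∷
       AllP.++⁺ (small-loop (start a c) cols (ℕP.≤-reflexive length-start+loop) degreeAtMost-start)
                (small-axiom ∷ []))
      small-r

    length-loop : ∀ S l → length (loopLines a c S l) ≡ length l ℕ.+ length l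
    length-loop S []      = refl
    length-loop S (j ∷ l) =
      cong suc (trans (cong suc (length-loop (accumulate a c S j) l)) (sym (ℕP.+-suc (length l) (length l))))

    length-block : ∀ axiom r → length (block a c axiom r) ≡ blockLength
    length-block axiom r = begin
      length (block a c axiom r)
        ≡⟨ LP.length-++ (start a c ∷ loopLines a c (start a c) cols ++ axiom ∷ []) ⟩
      suc (length (loopLines a c (start a c) cols ++ axiom ∷ [])) ℕ.+ 1
        ≡⟨ cong (λ l → suc l ℕ.+ 1) (LP.length-++ (loopLines a c (start a c) cols)) ⟩
      suc (length (loopLines a c (start a c) cols) ℕ.+ 1) ℕ.+ 1
        ≡⟨ cong (λ l → suc (l ℕ.+ 1) ℕ.+ 1)
             (trans (length-loop (start a c) cols) (cong₂ ℕ._+_ length-cols length-cols)) ⟩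
      suc ((N ℕ.+ N) ℕ.+ 1) ℕ.+ 1
        ≡⟨ solve 1 (λ M → (con 1 :+ (M :+ con 1)) :+ con 1 := con 3 :+ M) refl (N ℕ.+ N) ⟩
      blockLength ∎
      where
      open ≡-Reasoning
      open ℕSolver.+-*-Solver

    length-++-block : ∀ axiom r (lines : List (Poly n)) {k} → length lines ≤ suc (k ℕ.* blockLength) →
                      length (lines ++ block a c axiom r) ≤ suc (suc k ℕ.* blockLength)
    length-++-block axiom r lines {k} bound = begin
      length (lines ++ block a c axiom r)      ≡⟨ LP.length-++ lines ⟩
      length lines ℕ.+ length (block a c axiom r)
                                               ≡⟨ cong (length lines ℕ.+_) (length-block axiom r) ⟩
      length lines ℕ.+ blockLength             ≤⟨ ℕP.+-monoˡ-≤ blockLength bound ⟩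
      suc (k ℕ.* blockLength ℕ.+ blockLength)  ≡⟨ cong suc (ℕP.+-comm (k ℕ.* blockLength) blockLength) ⟩
      suc (suc k ℕ.* blockLength)              ∎
      where open ℕP.≤-Reasoning

  record Reached (a : Fin n) : Set where
    field
      value value⁻¹ : ℚ
      inverse       : value⁻¹ ℚ.* value ≡ 1ℚ
      lines         : List (Poly n)
      continuation  : Continuation [] lines
      reached       : eqn a value ∈ lines
      small         : All Small lines
      length-lines  : length lines ≤ suc (toℕ a ℕ.* blockLength)

  reached-zero : Reached fzero
  reached-zero = record
    { value = ½ ; value⁻¹ = fromℕℚ 2 ; inverse = refl
    ; lines = eqn fzero ½ ∷ [] ; continuation = byAxiom (here refl) ∷ []
    ; reached = here refl ; small = small-eqn fzero ½ ∷ [] ; length-lines = s≤s z≤n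
    }

  reached-suc : ∀ i → Reached (inject₁ i) → Reached (fsuc i)
  reached-suc i r = record
    { value = c ℚ.* c ; value⁻¹ = d ℚ.* d ; inverse = *-square-inverse {c} {d} inverse
    ; lines = lines ++ block a c axiom conclusion
    ; continuation = continuation ++ᶜ
                     block-continuation a c 1ℚ (ℚ.- 1ℚ) reached axiom∈Q conclusion≈
    ; reached = conclusion∈block a c axiom conclusion lines
    ; small = AllP.++⁺ small (small-block a c (small-squareAxiom a (fsuc i)) (small-eqn (fsuc i) (c ℚ.* c)))
    ; length-lines = length-++-block a c axiom conclusion lines {toℕ i}
                       (subst (λ k → length lines ≤ suc (k ℕ.* blockLength)) (FinP.toℕ-inject₁ i) length-lines)
    }
    where
    open Reached r renaming (value to c; value⁻¹ to d)
    a = inject₁ i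
    axiom = (ks a ⊗ ks a) ⊖ ks (fsuc i)
    conclusion = eqn (fsuc i) (c ℚ.* c)
    axiom∈Q : axiom ∈ Q n
    axiom∈Q = there (∈-++⁺ˡ (∈-map⁺ _ (∈-allFin i)))
    conclusion≈ : conclusion ≈ (scale 1ℚ (squareDifference a c) ⊕ scale (ℚ.- 1ℚ) axiom)
    conclusion≈ = ⊖-const-≈ {R = squareDifference a c} {K = ks a ⊗ ks a} {P = ks (fsuc i)} {s = c ℚ.* c}
                            (square-≈ a c)

  Refutation : Set
  Refutation = Σ (List (Poly n)) λ ps →
    IsRefutation (Q n) ps × degree ps ≤ 2 × monomialSize ps ≤ suc (n ℕ.* blockLength) ℕ.* B

  refutation-from : Reached (fromℕ m) → Refutation
  refutation-from r =
    ps , (isDerivation derivation , const 1ℚ , lines ++ body , sym (LP.++-assoc lines body _) , λ _ → refl) ,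
    degree≤ ps (All.map (λ {p} s → deg≤ p (proj₂ s)) small-ps) ,
    ℕP.≤-trans (monomialSize≤ ps (All.map (λ {p} s → ℕP.≤-trans (nMon≤length p) (proj₁ s)) small-ps))
               (ℕP.*-monoˡ-≤ B length-ps)
    where
    open Reached r renaming (value to c; value⁻¹ to d)
    a = fromℕ m
    body = start a c ∷ loopLines a c (start a c) cols ++ ks a ⊗ ks a ∷ []
    ps = lines ++ block a c (ks a ⊗ ks a) (const 1ℚ)
    one≈ : const 1ℚ ≈ (scale (ℚ.- (d ℚ.* d)) (squareDifference a c) ⊕ scale (d ℚ.* d) (ks a ⊗ ks a))
    one≈ = one-≈ {R = squareDifference a c} {K = ks a ⊗ ks a} {s = c ℚ.* c} {e = d ℚ.* d}
                 (*-square-inverse {c} {d} inverse) (square-≈ a c)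
    axiom∈Q : ks a ⊗ ks a ∈ Q n
    axiom∈Q = there (∈-++⁺ʳ _ (here refl))
    derivation : Continuation [] ps
    derivation = continuation ++ᶜ
                 block-continuation a c (ℚ.- (d ℚ.* d)) (d ℚ.* d) reached axiom∈Q one≈
    small-ps : All Small ps
    small-ps = AllP.++⁺ small (small-block a c (small-square a) (s≤s z≤n , degreeAtMost-const 1ℚ))
    length-ps : length ps ≤ suc (n ℕ.* blockLength)
    length-ps = length-++-block a c (ks a ⊗ ks a) (const 1ℚ) lines {m}
                  (subst (λ k → length lines ≤ suc (k ℕ.* blockLength)) (FinP.toℕ-fromℕ m) length-lines)

  refutation : Refutation
  refutation = refutation-from (<-weakInduction Reached reached-zero reached-suc (fromℕ m))

sizeBound : List ℕ
sizeBound = 4 ∷ 20 ∷ 44 ∷ 44 ∷ 16 ∷ []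

sizeBound-correct : ∀ n →
  suc (n ℕ.* (3 ℕ.+ ((n ℕ.+ n) ℕ.+ (n ℕ.+ n)))) ℕ.* ((2 ℕ.+ (n ℕ.+ n)) ℕ.* (2 ℕ.+ (n ℕ.+ n))) ≡ evalP sizeBound n
sizeBound-correct = solve 1 (λ n →
    (con 1 :+ n :* (con 3 :+ ((n :+ n) :+ (n :+ n)))) :* ((con 2 :+ (n :+ n)) :* (con 2 :+ (n :+ n)))
    := con 4 :+ n :* (con 20 :+ n :* (con 44 :+ n :* (con 44 :+ n :* (con 16 :+ n :* con 0)))))
  refl
  where open ℕSolver.+-*-Solver

lemma2 : Σ (List ℕ) λ P → (n : ℕ) → 1 ≤ n →
    Σ (List (Poly n)) λ ps →
      IsRefutation (Q n) ps × degree ps ≤ 2 × monomialSize ps ≤ evalP P n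
lemma2 = sizeBound , refutes
  where
  refutes : (n : ℕ) → 1 ≤ n → Σ (List (Poly n)) λ ps →
            IsRefutation (Q n) ps × degree ps ≤ 2 × monomialSize ps ≤ evalP sizeBound n
  refutes (suc m) _ = weaken-size (Refutation.refutation m)
    where
    weaken-size : Refutation.Refutation m → Σ (List (Poly (suc m))) λ ps →
                  IsRefutation (Q (suc m)) ps × degree ps ≤ 2 × monomialSize ps ≤ evalP sizeBound (suc m)
    weaken-size (ps , isRefutation , degree≤2 , size≤) =
      ps , isRefutation , degree≤2 , ℕP.≤-trans size≤ (ℕP.≤-reflexive (sizeBound-correct (suc m)))
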